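{- Let $G$ be a directed unweighted graph with source $s$, sink $t$ and $(s,t)$-min-cut size $\lambda$, in which every vertex lies on some simple $(s,t)$-path, and let $\mathcal{E}$ be a set of $k$ edges of $G$. Then deleting $\mathcal{E}$ reduces the $(s,t)$-min-cut size by exactly $k$ if and only if all edges of $\mathcal{E}$ are critical and form an anti-chain in the partial order on edges of $D_\lambda$ defined below.
   Context: Edges have unit capacity. Two vertices are equivalent if no $(s,t)$-min-cut separates them; $\mathbf{v}$ denotes the class of $v$. An edge $(x,y)$ is inter-cluster if $\mathbf{x}\ne\mathbf{y}$. An edge is critical if it lies in some $(s,t)$-min-cut (critical edges are inter-cluster). $G_\lambda$ is the quotient graph obtained by contracting each equivalence class to a node (keeping inter-cluster edges), and the strip graph $D_\lambda$ is obtained from $G_\lambda$ by reversing the direction of every non-critical inter-cluster edge; $D_\lambda$ is acyclic. On edges of $D_\lambda$, $e_x\le e_y$ iff there is a path from $\mathbf{s}$ to $\mathbf{t}$ in $D_\lambda$ in which $e_x$ precedes $e_y$ (or $e_x=e_y$); an anti-chain is a set of pairwise incomparable edges. Edges of $G$ are identified with their images in $D_\lambda$. -}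

module Defs where

open import Data.Nat using (ℕ; _≤_)
open import Data.Bool using (Bool; true; false; _∧_; not)
open import Data.Fin using (Fin)
open import Data.Fin.Subset using (Subset; _∈_; _∉_; ∣_∣) renaming (⊥ to ∅)
open import Data.Vec using (lookup; tabulate)
open import Data.List using (List; []; _∷_; _++_)
open import Data.List.Relation.Unary.Unique.Propositional using (Unique)
import Data.List.Membership.Propositional as LM
open import Data.Product using (Σ; _×_; ∃; ∃-syntax)
open import Data.Sum using (_⊎_)
open import Relation.Nullary using (¬_)
open import Relation.Binary.PropositionalEquality using (_≡_; _≢_)
open import Function.Bundles using (_⇔_)

-- A finite directed (multi)graph with vertices Fin n and edges Fin m;
-- edge e goes from src e to tgt e. All edges have unit capacity.
record Graph (n m : ℕ) : Set where
  field
    src tgt : Fin m → Fin n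
open Graph public

Simple : ∀ {n m} → Graph n m → Set
Simple G = (∀ e → src G e ≢ tgt G e)
         × (∀ e f → src G e ≡ src G f → tgt G e ≡ tgt G f → e ≡ f)

module _ {n m : ℕ} (G : Graph n m) (s t : Fin n) where

  data GWalk : Fin n → Fin n → List (Fin n) → Set where
    here : ∀ {x} → GWalk x x (x ∷ [])
    step : ∀ {x y vs} (e : Fin m) → src G e ≡ x → GWalk (tgt G e) y vs
         → GWalk x y (x ∷ vs)

  OnSimpleSTPath : Fin n → Set
  OnSimpleSTPath v = ∃[ vs ] (GWalk s t vs × Unique vs × v LM.∈ vs)

  STCut : Subset n → Set
  STCut S = s ∈ S × t ∉ S

  -- the edges of G ∖ D leaving S (the cut edges of S after deleting D)
  cutEdges : Subset m → Subset n → Subset m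
  cutEdges D S = tabulate (λ e → lookup S (src G e) ∧ not (lookup S (tgt G e)) ∧ not (lookup D e))

  cutSize : Subset m → Subset n → ℕ
  cutSize D S = ∣ cutEdges D S ∣

  IsMinCutSize : Subset m → ℕ → Set
  IsMinCutSize D c = (∃[ S ] (STCut S × cutSize D S ≡ c))
                   × (∀ S → STCut S → c ≤ cutSize D S)

  IsMinCut : Subset n → Set
  IsMinCut S = STCut S × (∀ S' → STCut S' → cutSize ∅ S ≤ cutSize ∅ S')

  Equiv : Fin n → Fin n → Set
  Equiv u v = ∀ S → IsMinCut S → (u ∈ S ⇔ v ∈ S)

  InterCluster : Fin m → Set
  InterCluster e = ¬ Equiv (src G e) (tgt G e)

  Critical : Fin m → Set
  Critical e = ∃[ S ] (IsMinCut S × src G e ∈ S × tgt G e ∉ S)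

  -- DArc e x y : e is an edge of the strip graph D_λ going from the class of x
  -- to the class of y (critical edges keep direction, non-critical
  -- inter-cluster edges are reversed, intra-cluster edges are contracted away)
  DArc : Fin m → Fin n → Fin n → Set
  DArc e x y = InterCluster e ×
    ((Critical e × x ≡ src G e × y ≡ tgt G e) ⊎
     (¬ Critical e × x ≡ tgt G e × y ≡ src G e))

  data DPath : Fin n → Fin n → List (Fin m) → Set where
    nil  : ∀ {x y} → Equiv x y → DPath x y []
    cons : ∀ {x a b y es} (e : Fin m) → DArc e a b → Equiv x a → DPath b y es
         → DPath x y (e ∷ es)

  _≼_ : Fin m → Fin m → Set
  e ≼ f = e ≡ f ⊎
    (∃[ p ] ∃[ q ] ∃[ r ] DPath s t (p ++ (e ∷ (q ++ (f ∷ r)))))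

  AllCritical : Subset m → Set
  AllCritical E = ∀ e → e ∈ E → Critical e

  AntiChain : Subset m → Set
  AntiChain E = ∀ e f → e ∈ E → f ∈ E → e ≢ f → ¬ (e ≼ f)

-- Compute a maximum flow φ by augmenting paths. For it the (s,t)-min-cuts are exactly
-- the (s,t)-cuts closed under residual arcs: critical edges are saturated, and every arc
-- of D_λ is a reversed residual arc, so min cuts are closed under predecessors in D_λ.
-- Since every vertex lies on an (s,t)-path, it is reachable from s and reaches t in D_λ.
--
-- Deleting E lowers λ by |E| exactly when some min cut is crossed by every edge of E.
-- Such a cut shows each edge critical, and a D_λ-path through e and then f would leave
-- the cut at e and have to re-enter it before f. Conversely, the residual closure of s
-- and the tails of E misses t (a min cut through the start of any residual walk is
-- closed) and misses every head of E (otherwise f ⇝ e for some e ≠ f in E), so it is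
-- a min cut crossed by all of E.

module Submission where

open import Defs
open import Data.Bool using (Bool; true; false; _∧_; _∨_; not; if_then_else_)
import Data.Bool.Properties as Boolₚ
open import Data.Empty using (⊥-elim)
open import Data.Fin using (Fin; zero; suc)
import Data.Fin.Properties as Finₚ
open import Data.Fin.Subset using (Subset; _∈_; _∉_; ∣_∣) renaming (⊥ to ∅)
open import Data.Fin.Subset.Properties using (_∈?_; anySubset?)
open import Data.List using (List; []; _∷_; _++_)
import Data.List.Membership.Propositional as List
open import Data.List.Relation.Unary.All as All using (All; []; _∷_)
open import Data.List.Relation.Unary.AllPairs using ([]; _∷_)
open import Data.List.Relation.Unary.Any using (here; there)
open import Data.List.Relation.Unary.Unique.Propositional using (Unique)
open import Data.Nat using (ℕ; zero; suc; _+_; _*_; _≤_; _<_; z≤n; s≤s; _≤?_)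
open import Data.Nat.Properties
open import Data.Nat.Tactic.RingSolver using (solve-∀)
open import Data.Product using (_×_; _,_; proj₁; proj₂; ∃-syntax)
open import Data.Sum as Sum using (_⊎_; inj₁; inj₂)
open import Data.Vec using ([]; _∷_; lookup; tabulate)
import Data.Vec.Properties as Vecₚ
open import Function using (_∘_)
open import Function.Bundles using (_⇔_; mk⇔; Equivalence)
import Function.Properties.Equivalence as ⇔
open import Relation.Nullary using (¬_; Dec; yes; no; does; contradiction)
import Relation.Nullary.Decidable as Dec
open import Relation.Nullary.Decidable using (_×-dec_; _⊎-dec_; _→-dec_; ¬?; decidable-stable; dec-true; dec-false)
open import Relation.Binary.PropositionalEquality

∧≡true : ∀ {a b} → a ∧ b ≡ true → a ≡ true × b ≡ true
∧≡true {true} {true} _ = refl , refl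

not≡true : ∀ {a} → not a ≡ true → a ≡ false
not≡true {false} _ = refl

≡true⇒≢false : ∀ {b} → b ≡ true → b ≢ false
≡true⇒≢false refl ()

⟦_⟧ : Bool → ℕ
⟦ true ⟧ = 1
⟦ false ⟧ = 0

⟦⟧-mono : ∀ {a b} → (a ≡ true → b ≡ true) → ⟦ a ⟧ ≤ ⟦ b ⟧
⟦⟧-mono {false} a⇒b = z≤n
⟦⟧-mono {true} a⇒b rewrite a⇒b refl = ≤-refl

count : ∀ {k} → (Fin k → Bool) → ℕ
count {zero} P = 0
count {suc k} P = ⟦ P zero ⟧ + count (P ∘ suc)

count-cong : ∀ {k} {P Q : Fin k → Bool} → (∀ i → P i ≡ Q i) → count P ≡ count Q
count-cong {zero} eq = refl
count-cong {suc k} eq = cong₂ _+_ (cong ⟦_⟧ (eq zero)) (count-cong (eq ∘ suc))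

count-mono : ∀ {k} {P Q : Fin k → Bool} → (∀ i → P i ≡ true → Q i ≡ true) → count P ≤ count Q
count-mono {zero} P⊆Q = z≤n
count-mono {suc k} P⊆Q = +-mono-≤ (⟦⟧-mono (P⊆Q zero)) (count-mono (P⊆Q ∘ suc))

count-pos : ∀ {k} (P : Fin k → Bool) i → P i ≡ true → 0 < count P
count-pos P zero p rewrite p = s≤s z≤n
count-pos P (suc i) p = ≤-trans (count-pos (P ∘ suc) i p) (m≤n+m _ ⟦ P zero ⟧)

count≡0 : ∀ {k} (P : Fin k → Bool) → count P ≡ 0 → ∀ i → P i ≡ false
count≡0 P eq i with P i in p
... | false = refl
... | true = contradiction (subst (0 <_) eq (count-pos P i p)) λ ()

count-none : ∀ {k} (P : Fin k → Bool) → (∀ i → P i ≡ false) → count P ≡ 0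
count-none {zero} P none = refl
count-none {suc k} P none rewrite none zero = count-none (P ∘ suc) (none ∘ suc)

count-split : ∀ {k} (P Q : Fin k → Bool) →
  count P ≡ count (λ i → P i ∧ Q i) + count (λ i → P i ∧ not (Q i))
count-split {zero} P Q = refl
count-split {suc k} P Q
  rewrite count-split (P ∘ suc) (Q ∘ suc) with P zero | Q zero
... | false | _ = refl
... | true | true = refl
... | true | false = sym (+-suc _ _)

count-∧⊆ : ∀ {k} (P Q : Fin k → Bool) → count P ≤ count (λ i → P i ∧ Q i) →
  ∀ i → P i ≡ true → Q i ≡ true
count-∧⊆ P Q full i p with Q i in q
... | true = refl
... | false = ⊥-elim (≡true⇒≢false (cong₂ (λ a b → a ∧ not b) p q) (count≡0 _ rest≡0 i))
  where
  rest≡0 : count (λ i → P i ∧ not (Q i)) ≡ 0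
  rest≡0 = n≤0⇒n≡0 (+-cancelˡ-≤ (count (λ i → P i ∧ Q i)) _ 0
    (subst₂ _≤_ (count-split P Q) (sym (+-identityʳ _)) full))

count-update : ∀ {k} {P Q : Fin k → Bool} i → (∀ j → j ≢ i → P j ≡ Q j) →
  count P + ⟦ Q i ⟧ ≡ count Q + ⟦ P i ⟧
count-update {P = P} {Q} zero agree
  rewrite count-cong {P = P ∘ suc} {Q ∘ suc} (λ j → agree (suc j) λ ())
  = swap ⟦ P zero ⟧ (count (Q ∘ suc)) ⟦ Q zero ⟧
  where
  swap : ∀ a c b → a + c + b ≡ b + c + a
  swap = solve-∀
count-update {P = P} {Q} (suc i) agree
  rewrite agree zero (λ ())
        | +-assoc ⟦ Q zero ⟧ (count (P ∘ suc)) ⟦ Q (suc i) ⟧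
        | +-assoc ⟦ Q zero ⟧ (count (Q ∘ suc)) ⟦ P (suc i) ⟧
  = cong (⟦ Q zero ⟧ +_) (count-update i (λ j j≢i → agree (suc j) (j≢i ∘ Finₚ.suc-injective)))

card≡count : ∀ {k} (S : Subset k) → ∣ S ∣ ≡ count (lookup S)
card≡count [] = refl
card≡count (true ∷ S) = cong suc (card≡count S)
card≡count (false ∷ S) = card≡count S

singleton : ∀ {k} → Fin k → Fin k → Bool
singleton x y = does (y Finₚ.≟ x)

witness : ∀ {a} {A : Set a} (a? : Dec A) → does a? ≡ true → A
witness (yes a) _ = a

∈⇒lookup : ∀ {k} {x : Fin k} {S : Subset k} → x ∈ S → lookup S x ≡ true
∈⇒lookup = Vecₚ.[]=⇒lookup

lookup⇒∈ : ∀ {k} {x : Fin k} {S : Subset k} → lookup S x ≡ true → x ∈ S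
lookup⇒∈ = Vecₚ.lookup⇒[]= _ _

∉⇒lookup : ∀ {k} {x : Fin k} {S : Subset k} → x ∉ S → lookup S x ≡ false
∉⇒lookup {x = x} {S} x∉S with lookup S x in Sx
... | true = contradiction (lookup⇒∈ Sx) x∉S
... | false = refl

lookup⇒∉ : ∀ {k} {x : Fin k} {S : Subset k} → lookup S x ≡ false → x ∉ S
lookup⇒∉ Sx x∈S = ≡true⇒≢false (∈⇒lookup x∈S) Sx

allSubset? : ∀ {k} {P : Subset k → Set} → (∀ S → Dec (P S)) → Dec (∀ S → P S)
allSubset? P? with anySubset? (¬? ∘ P?)
... | yes (S , ¬PS) = no λ all → ¬PS (all S)
... | no ∄¬P = yes λ S → decidable-stable (P? S) λ ¬PS → ∄¬P (S , ¬PS)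

_⇔?_ : ∀ {A B : Set} → Dec A → Dec B → Dec (A ⇔ B)
A? ⇔? B? = Dec.map′ (λ (f , g) → mk⇔ f g) (λ A⇔B → Equivalence.to A⇔B , Equivalence.from A⇔B)
  ((A? →-dec B?) ×-dec (B? →-dec A?))

module Reachability {n m : ℕ} (src tgt : Fin m → Fin n) (Arc : Fin m → Fin n → Fin n → Set)
  (arc? : ∀ e x y → Dec (Arc e x y))
  (arc-ends : ∀ {e x y} → Arc e x y → (src e ≡ x × tgt e ≡ y) ⊎ (src e ≡ y × tgt e ≡ x)) where

  data Walk : Fin n → Fin n → List (Fin m) → Set where
    nil : ∀ {x} → Walk x x []
    snoc : ∀ {x y z es} → Walk x y es → (e : Fin m) → Arc e y z → Walk x z (e ∷ es)

  Closed : (Fin n → Bool) → Set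
  Closed C = ∀ {e x y} → Arc e x y → C x ≡ true → C y ≡ true

  walk-closed : ∀ {C x y es} → Closed C → Walk x y es → C x ≡ true → C y ≡ true
  walk-closed closed nil Cx = Cx
  walk-closed closed (snoc w e a) Cx = closed a (walk-closed closed w Cx)

  ReachableFrom : (Fin n → Bool) → Fin n → Set
  ReachableFrom X z = ∃[ x ] X x ≡ true × ∃[ es ] Walk x z es × Unique es

  record Closure (X : Fin n → Bool) : Set where
    field
      C : Fin n → Bool
      ⊇X : ∀ v → X v ≡ true → C v ≡ true
      closed : Closed C
      reachable : ∀ z → C z ≡ true → ReachableFrom X z

  private
    Inside : (Fin n → Bool) → Fin m → Set
    Inside C e = C (src e) ≡ true × C (tgt e) ≡ true

    arc-inside : ∀ {C e x y} → Arc e x y → C x ≡ true → C y ≡ true → Inside C e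
    arc-inside a Cx Cy with arc-ends a
    ... | inj₁ (refl , refl) = Cx , Cy
    ... | inj₂ (refl , refl) = Cy , Cx

    arc-leaving-outside : ∀ {C e x y} → Arc e x y → C y ≡ false → ¬ Inside C e
    arc-leaving-outside a Cy (Csrc , Ctgt) with arc-ends a
    ... | inj₁ (refl , refl) = ≡true⇒≢false Ctgt Cy
    ... | inj₂ (refl , refl) = ≡true⇒≢false Csrc Cy

    -- Walks whose edges stay inside C remain edge-simple when extended by an arc leaving C.
    ReachInside : (X C : Fin n → Bool) → Set
    ReachInside X C = ∀ z → C z ≡ true →
      ∃[ x ] X x ≡ true × ∃[ es ] Walk x z es × Unique es × All (Inside C) es

    insert : (Fin n → Bool) → Fin n → Fin n → Bool
    insert C w v = C v ∨ does (v Finₚ.≟ w)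

    insert-⊇ : ∀ C w {v} → C v ≡ true → insert C w v ≡ true
    insert-⊇ C w Cv rewrite Cv = refl

    insert-new : ∀ C w → insert C w w ≡ true
    insert-new C w rewrite dec-true (w Finₚ.≟ w) refl = Boolₚ.∨-zeroʳ (C w)

    insert-away : ∀ C w {v} → v ≢ w → insert C w v ≡ C v
    insert-away C w {v} v≢w rewrite dec-false (v Finₚ.≟ w) v≢w = Boolₚ.∨-identityʳ (C v)

    Exit : (Fin n → Bool) → Set
    Exit C = ∃[ e ] ∃[ x ] ∃[ y ] Arc e x y × C x ≡ true × C y ≡ false

    exit? : ∀ C → Dec (Exit C)
    exit? C = Finₚ.any? λ e → Finₚ.any? λ x → Finₚ.any? λ y →
      arc? e x y ×-dec (C x Boolₚ.≟ true) ×-dec (C y Boolₚ.≟ false)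

    insert-holes : ∀ C {y} → C y ≡ false → count (not ∘ C) ≡ suc (count (not ∘ insert C y))
    insert-holes C {y} Cy = begin
      count (not ∘ C)                             ≡˘⟨ +-identityʳ _ ⟩
      count (not ∘ C) + 0                         ≡˘⟨ cong (λ b → count (not ∘ C) + ⟦ not b ⟧) (insert-new C y) ⟩
      count (not ∘ C) + ⟦ not (insert C y y) ⟧    ≡˘⟨ count-update y (λ j j≢y → cong not (insert-away C y j≢y)) ⟩
      count (not ∘ insert C y) + ⟦ not (C y) ⟧    ≡⟨ cong (λ b → count (not ∘ insert C y) + ⟦ not b ⟧) Cy ⟩
      count (not ∘ insert C y) + 1                ≡⟨ +-comm _ 1 ⟩
      suc (count (not ∘ insert C y))              ∎
      where open ≡-Reasoning

    inside-insert : ∀ {C y e} → Inside C e → Inside (insert C y) e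
    inside-insert {C} {y} (Csrc , Ctgt) = insert-⊇ C y Csrc , insert-⊇ C y Ctgt

    grow : ∀ k X C → count (not ∘ C) ≡ k → (∀ v → X v ≡ true → C v ≡ true) → ReachInside X C → Closure X
    grow k X C holes ⊇X reach with exit? C
    ... | no noExit = record { C = C ; ⊇X = ⊇X ; closed = closed ; reachable = reachable }
      where
      closed : Closed C
      closed {e} {x} {y} a Cx with C y in Cy
      ... | true = refl
      ... | false = contradiction (e , x , y , a , Cx , Cy) noExit
      reachable : ∀ z → C z ≡ true → ReachableFrom X z
      reachable z Cz with reach z Cz
      ... | x , Xx , es , w , unique , _ = x , Xx , es , w , unique
    ... | yes (e , x , y , a , Cx , Cy) with k
    ...   | zero = contradiction (trans (sym (insert-holes C Cy)) holes) λ ()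
    ...   | suc k = grow k X (insert C y) (suc-injective (trans (sym (insert-holes C Cy)) holes))
                      (λ v Xv → insert-⊇ C y (⊇X v Xv)) reach′
      where
      reach′ : ReachInside X (insert C y)
      reach′ v C′v with v Finₚ.≟ y
      ... | yes refl with reach x Cx
      ...   | x₀ , Xx₀ , es , w , unique , inside =
        x₀ , Xx₀ , e ∷ es , snoc w e a ,
        All.map (λ insideF e≡f → arc-leaving-outside a Cy (subst (Inside C) (sym e≡f) insideF)) inside ∷ unique ,
        arc-inside a (insert-⊇ C v Cx) (insert-new C v) ∷ All.map (inside-insert {C}) inside
      reach′ v C′v | no _ with reach v (trans (sym (Boolₚ.∨-identityʳ (C v))) C′v)
      ...   | x₀ , Xx₀ , es , w , unique , inside = x₀ , Xx₀ , es , w , unique , All.map (inside-insert {C}) inside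

  closure : ∀ X → Closure X
  closure X = grow _ X X refl (λ _ Xv → Xv) λ z Xz → z , Xz , [] , nil , [] , []

module Network {n m : ℕ} (G : Graph n m) (s t : Fin n) where

  NoExit : (Fin n → Bool) → Set
  NoExit B = ∀ e → B (src G e) ≡ true → B (tgt G e) ≡ true

  walk-stays-within : ∀ {B x y vs v} → NoExit B → GWalk G s t x y vs → B x ≡ true →
    v List.∈ vs → B v ≡ true
  walk-stays-within noExit here Bx (here refl) = Bx
  walk-stays-within noExit (step e refl w) Bx (here refl) = Bx
  walk-stays-within noExit (step e refl w) Bx (there v∈vs) = walk-stays-within noExit w (noExit e Bx) v∈vs

  walk-stays : ∀ {B x y vs} → NoExit B → GWalk G s t x y vs → B x ≡ true → B y ≡ true
  walk-stays noExit here Bx = Bx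
  walk-stays noExit (step e refl w) Bx = walk-stays noExit w (noExit e Bx)

  walk-stays-after : ∀ {B x y vs v} → NoExit B → GWalk G s t x y vs → v List.∈ vs →
    B v ≡ true → B y ≡ true
  walk-stays-after noExit here (here refl) Bv = Bv
  walk-stays-after {B} noExit w@(step _ _ _) (here refl) Bv = walk-stays {B} noExit w Bv
  walk-stays-after noExit (step e refl w) (there v∈vs) Bv = walk-stays-after noExit w v∈vs Bv

  outE inE : (Fin n → Bool) → Fin m → Bool
  outE S e = S (src G e) ∧ not (S (tgt G e))
  inE S e = not (S (src G e)) ∧ S (tgt G e)

  count-outE≡0⇒NoExit : ∀ B → count (outE B) ≡ 0 → NoExit B
  count-outE≡0⇒NoExit B none e Bsrc with B (tgt G e) in Btgt
  ... | true = refl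
  ... | false = ⊥-elim (≡true⇒≢false (cong₂ (λ a b → a ∧ not b) Bsrc Btgt) (count≡0 (outE B) none e))

  cutSize≡count : ∀ D S {B} → (∀ v → lookup S v ≡ B v) →
    cutSize G s t D S ≡ count (λ e → outE B e ∧ not (lookup D e))
  cutSize≡count D S {B} S≗B = begin
    ∣ cutEdges G s t D S ∣                      ≡⟨ card≡count (cutEdges G s t D S) ⟩
    count (lookup (cutEdges G s t D S))        ≡⟨ count-cong pointwise ⟩
    count (λ e → outE B e ∧ not (lookup D e)) ∎
    where
    open ≡-Reasoning
    pointwise : ∀ e → lookup (cutEdges G s t D S) e ≡ outE B e ∧ not (lookup D e)
    pointwise e rewrite Vecₚ.lookup∘tabulate (λ e → lookup S (src G e) ∧ not (lookup S (tgt G e)) ∧ not (lookup D e)) e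
                      | S≗B (src G e) | S≗B (tgt G e)
      = sym (Boolₚ.∧-assoc (B (src G e)) _ _)

  cutSize-∅ : ∀ S {B} → (∀ v → lookup S v ≡ B v) → cutSize G s t ∅ S ≡ count (outE B)
  cutSize-∅ S {B} S≗B = trans (cutSize≡count ∅ S S≗B) (count-cong λ e →
    trans (cong (λ d → outE B e ∧ not d) (Vecₚ.lookup-replicate e false)) (Boolₚ.∧-identityʳ _))

  cutSize-split : ∀ D S {B} → (∀ v → lookup S v ≡ B v) →
    cutSize G s t ∅ S ≡ count (λ e → lookup D e ∧ outE B e) + cutSize G s t D S
  cutSize-split D S {B} S≗B = begin
    cutSize G s t ∅ S
      ≡⟨ cutSize-∅ S S≗B ⟩
    count (outE B)
      ≡⟨ count-split (outE B) (lookup D) ⟩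
    count (λ e → outE B e ∧ lookup D e) + count (λ e → outE B e ∧ not (lookup D e))
      ≡⟨ cong₂ _+_ (count-cong λ e → Boolₚ.∧-comm (outE B e) _) (sym (cutSize≡count D S S≗B)) ⟩
    count (λ e → lookup D e ∧ outE B e) + cutSize G s t D S
      ∎
    where open ≡-Reasoning

  outE⇒crossing : ∀ {S e} → outE (lookup S) e ≡ true → src G e ∈ S × tgt G e ∉ S
  outE⇒crossing out with ∧≡true out
  ... | src∈S , tgt∉S = lookup⇒∈ src∈S , lookup⇒∉ (not≡true tgt∉S)

  deleted-crossing≤ : ∀ E {B} → count (λ e → lookup E e ∧ outE B e) ≤ ∣ E ∣
  deleted-crossing≤ E {B} = subst (count (λ e → lookup E e ∧ outE B e) ≤_) (sym (card≡count E))
    (count-mono {Q = lookup E} λ e → proj₁ ∘ ∧≡true)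

  tabulate-cut : ∀ {C} → C s ≡ true → C t ≡ false → STCut G s t (tabulate C)
  tabulate-cut {C} Cs Ct =
    lookup⇒∈ (trans (Vecₚ.lookup∘tabulate C s) Cs) , lookup⇒∉ (trans (Vecₚ.lookup∘tabulate C t) Ct)

  -- Flows and augmenting paths

  fOut fIn : (Fin m → Bool) → (Fin n → Bool) → ℕ
  fOut φ S = count (λ e → outE S e ∧ φ e)
  fIn φ S = count (λ e → inE S e ∧ φ e)

  -- A 0/1 flow of value v; conservation is imposed across every vertex set, not just at vertices.
  IsFlow : (Fin m → Bool) → ℕ → Set
  IsFlow φ v = ∀ S → fOut φ S + ⟦ S t ⟧ * v ≡ fIn φ S + ⟦ S s ⟧ * v

  empty-flow : IsFlow (λ _ → false) 0
  empty-flow S = begin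
    fOut (λ _ → false) S + ⟦ S t ⟧ * 0  ≡⟨ cong₂ _+_ (count-none _ (Boolₚ.∧-zeroʳ ∘ outE S)) (*-zeroʳ ⟦ S t ⟧) ⟩
    0                                   ≡˘⟨ cong₂ _+_ (count-none _ (Boolₚ.∧-zeroʳ ∘ inE S)) (*-zeroʳ ⟦ S s ⟧) ⟩
    fIn (λ _ → false) S + ⟦ S s ⟧ * 0   ∎
    where open ≡-Reasoning

  data Residual (φ : Fin m → Bool) : Fin m → Fin n → Fin n → Set where
    forward : ∀ {e} → φ e ≡ false → Residual φ e (src G e) (tgt G e)
    backward : ∀ {e} → φ e ≡ true → Residual φ e (tgt G e) (src G e)

  residual? : ∀ φ e x y → Dec (Residual φ e x y)
  residual? φ e x y = Dec.map (mk⇔ from to)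
    ((src G e Finₚ.≟ x ×-dec tgt G e Finₚ.≟ y ×-dec φ e Boolₚ.≟ false) ⊎-dec
     (tgt G e Finₚ.≟ x ×-dec src G e Finₚ.≟ y ×-dec φ e Boolₚ.≟ true))
    where
    Unfolded = (src G e ≡ x × tgt G e ≡ y × φ e ≡ false) ⊎ (tgt G e ≡ x × src G e ≡ y × φ e ≡ true)
    from : Unfolded → Residual φ e x y
    from (inj₁ (refl , refl , φe)) = forward φe
    from (inj₂ (refl , refl , φe)) = backward φe
    to : Residual φ e x y → Unfolded
    to (forward φe) = inj₁ (refl , refl , φe)
    to (backward φe) = inj₂ (refl , refl , φe)

  residual-ends : ∀ {φ e x y} → Residual φ e x y → (src G e ≡ x × tgt G e ≡ y) ⊎ (src G e ≡ y × tgt G e ≡ x)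
  residual-ends (forward _) = inj₁ (refl , refl)
  residual-ends (backward _) = inj₂ (refl , refl)

  residual-resp : ∀ {φ ψ e x y} → ψ e ≡ φ e → Residual φ e x y → Residual ψ e x y
  residual-resp ψe≡φe (forward φe) = forward (trans ψe≡φe φe)
  residual-resp ψe≡φe (backward φe) = backward (trans ψe≡φe φe)

  module ResidualReach (φ : Fin m → Bool) = Reachability (src G) (tgt G) (Residual φ) (residual? φ) residual-ends
  open ResidualReach using (nil; snoc)

  module ReverseReach (φ : Fin m → Bool) =
    Reachability (src G) (tgt G) (λ e x y → Residual φ e y x) (λ e x y → residual? φ e y x) (Sum.swap ∘ residual-ends)

  toggle : (Fin m → Bool) → Fin m → Fin m → Bool
  toggle ψ e i = if does (i Finₚ.≟ e) then not (ψ i) else ψ i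

  toggle-at : ∀ ψ e → toggle ψ e e ≡ not (ψ e)
  toggle-at ψ e rewrite dec-true (e Finₚ.≟ e) refl = refl

  toggle-away : ∀ ψ {e i} → i ≢ e → toggle ψ e i ≡ ψ i
  toggle-away ψ {e} {i} i≢e rewrite dec-false (i Finₚ.≟ e) i≢e = refl

  residual-crossing : ∀ {ψ e y z} → Residual ψ e y z → ∀ S →
    ⟦ outE S e ∧ not (ψ e) ⟧ + ⟦ inE S e ∧ ψ e ⟧ + ⟦ S z ⟧
      ≡ ⟦ outE S e ∧ ψ e ⟧ + ⟦ inE S e ∧ not (ψ e) ⟧ + ⟦ S y ⟧
  residual-crossing {e = e} (forward ψe) S rewrite ψe with S (src G e) | S (tgt G e)
  ... | true | true = refl
  ... | true | false = refl
  ... | false | true = refl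
  ... | false | false = refl
  residual-crossing {e = e} (backward ψe) S rewrite ψe with S (src G e) | S (tgt G e)
  ... | true | true = refl
  ... | true | false = refl
  ... | false | true = refl
  ... | false | false = refl

  -- Toggling a residual arc y → z moves one unit of excess from y to z.
  toggle-residual : ∀ {ψ e y z} → Residual ψ e y z → ∀ S →
    fOut (toggle ψ e) S + fIn ψ S + ⟦ S z ⟧ ≡ fOut ψ S + fIn (toggle ψ e) S + ⟦ S y ⟧
  toggle-residual {ψ} {e} {y} {z} r S = exchange (fOut ψ S) (fOut ψ′ S) (fIn ψ S) (fIn ψ′ S)
    (trans (count-update e (agree (outE S))) (cong (λ b → fOut ψ S + ⟦ outE S e ∧ b ⟧) (toggle-at ψ e)))
    (trans (count-update e (agree (inE S))) (cong (λ b → fIn ψ S + ⟦ inE S e ∧ b ⟧) (toggle-at ψ e)))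
    (residual-crossing r S)
    where
    ψ′ = toggle ψ e
    agree : ∀ A j → j ≢ e → A j ∧ ψ′ j ≡ A j ∧ ψ j
    agree A j j≢e = cong (A j ∧_) (toggle-away ψ j≢e)
    exchange : ∀ a a′ b b′ {p q r u} → a′ + q ≡ a + p → b′ + u ≡ b + r → p + u + ⟦ S z ⟧ ≡ q + r + ⟦ S y ⟧ →
      a′ + b + ⟦ S z ⟧ ≡ a + b′ + ⟦ S y ⟧
    exchange a a′ b b′ {p} {q} {r} {u} outΔ inΔ crossing = +-cancelʳ-≡ (q + r) _ _ (begin
      a′ + b + Z + (q + r)      ≡⟨ regroup₁ a′ b Z q r ⟩
      (a′ + q) + (b + r) + Z    ≡⟨ cong₂ (λ x y → x + y + Z) outΔ (sym inΔ) ⟩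
      (a + p) + (b′ + u) + Z    ≡⟨ regroup₂ a p b′ u Z ⟩
      a + b′ + (p + u + Z)      ≡⟨ cong (a + b′ +_) crossing ⟩
      a + b′ + (q + r + Y)      ≡⟨ regroup₃ a b′ q r Y ⟩
      a + b′ + Y + (q + r)      ∎)
      where
      open ≡-Reasoning
      Y = ⟦ S y ⟧
      Z = ⟦ S z ⟧
      regroup₁ : ∀ a′ b Z q r → a′ + b + Z + (q + r) ≡ (a′ + q) + (b + r) + Z
      regroup₁ = solve-∀
      regroup₂ : ∀ a p b′ u Z → (a + p) + (b′ + u) + Z ≡ a + b′ + (p + u + Z)
      regroup₂ = solve-∀
      regroup₃ : ∀ a b′ q r Y → a + b′ + (q + r + Y) ≡ a + b′ + Y + (q + r)
      regroup₃ = solve-∀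

  -- ψ is a flow of value v plus one further unit that leaves s and, so far, ends at y.
  IsFlow+1 : (Fin m → Bool) → ℕ → Fin n → Set
  IsFlow+1 ψ v y = ∀ S → fOut ψ S + ⟦ S t ⟧ * v + ⟦ S y ⟧ ≡ fIn ψ S + ⟦ S s ⟧ * suc v

  flow⇒flow+1 : ∀ {φ v} → IsFlow φ v → IsFlow+1 φ v s
  flow⇒flow+1 {φ} {v} flow S = begin
    fOut φ S + ⟦ S t ⟧ * v + ⟦ S s ⟧   ≡⟨ cong (_+ ⟦ S s ⟧) (flow S) ⟩
    fIn φ S + ⟦ S s ⟧ * v + ⟦ S s ⟧    ≡⟨ +-assoc (fIn φ S) _ _ ⟩
    fIn φ S + (⟦ S s ⟧ * v + ⟦ S s ⟧)  ≡⟨ cong (fIn φ S +_) (trans (+-comm _ ⟦ S s ⟧) (sym (*-suc ⟦ S s ⟧ v))) ⟩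
    fIn φ S + ⟦ S s ⟧ * suc v          ∎
    where open ≡-Reasoning

  flow+1-toggle : ∀ {ψ v e y z} → IsFlow+1 ψ v y → Residual ψ e y z → IsFlow+1 (toggle ψ e) v z
  flow+1-toggle {ψ} {v} {e} {y} {z} flow r S = +-cancelʳ-≡ (fIn ψ S) _ _ (begin
    fOut ψ′ S + T + Z + fIn ψ S            ≡⟨ regroup₁ (fOut ψ′ S) T Z (fIn ψ S) ⟩
    (fOut ψ′ S + fIn ψ S + Z) + T          ≡⟨ cong (_+ T) (toggle-residual r S) ⟩
    (fOut ψ S + fIn ψ′ S + Y) + T          ≡⟨ regroup₂ (fOut ψ S) (fIn ψ′ S) Y T ⟩
    (fOut ψ S + T + Y) + fIn ψ′ S          ≡⟨ cong (_+ fIn ψ′ S) (flow S) ⟩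
    fIn ψ S + ⟦ S s ⟧ * suc v + fIn ψ′ S   ≡⟨ regroup₃ (fIn ψ S) (⟦ S s ⟧ * suc v) (fIn ψ′ S) ⟩
    fIn ψ′ S + ⟦ S s ⟧ * suc v + fIn ψ S   ∎)
    where
    open ≡-Reasoning
    ψ′ = toggle ψ e
    T = ⟦ S t ⟧ * v
    Y = ⟦ S y ⟧
    Z = ⟦ S z ⟧
    regroup₁ : ∀ a′ T Z b → a′ + T + Z + b ≡ (a′ + b + Z) + T
    regroup₁ = solve-∀
    regroup₂ : ∀ a b′ Y T → (a + b′ + Y) + T ≡ (a + T + Y) + b′
    regroup₂ = solve-∀
    regroup₃ : ∀ b N b′ → b + N + b′ ≡ b′ + N + b
    regroup₃ = solve-∀

  flow+1⇒flow : ∀ {ψ v} → IsFlow+1 ψ v t → IsFlow ψ (suc v)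
  flow+1⇒flow {ψ} {v} flow S = begin
    fOut ψ S + ⟦ S t ⟧ * suc v         ≡⟨ cong (fOut ψ S +_) (trans (*-suc ⟦ S t ⟧ v) (+-comm ⟦ S t ⟧ _)) ⟩
    fOut ψ S + (⟦ S t ⟧ * v + ⟦ S t ⟧)  ≡˘⟨ +-assoc (fOut ψ S) _ _ ⟩
    fOut ψ S + ⟦ S t ⟧ * v + ⟦ S t ⟧    ≡⟨ flow S ⟩
    fIn ψ S + ⟦ S s ⟧ * suc v          ∎
    where open ≡-Reasoning

  augment : (Fin m → Bool) → List (Fin m) → Fin m → Bool
  augment φ [] = φ
  augment φ (e ∷ es) = toggle (augment φ es) e

  augment-away : ∀ φ {e} es → All (e ≢_) es → augment φ es e ≡ φ e
  augment-away φ [] [] = refl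
  augment-away φ (f ∷ es) (e≢f ∷ e∉es) = trans (toggle-away (augment φ es) e≢f) (augment-away φ es e∉es)

  augment-along : ∀ {φ v y es} → IsFlow φ v → ResidualReach.Walk φ s y es → Unique es →
    IsFlow+1 (augment φ es) v y
  augment-along flow nil [] = flow⇒flow+1 flow
  augment-along {φ} flow (snoc {es = es} w e r) (e∉es ∷ unique) =
    flow+1-toggle (augment-along flow w unique) (residual-resp (augment-away φ es e∉es) r)

  augmenting-path : ∀ {φ v es} → IsFlow φ v → ResidualReach.Walk φ s t es → Unique es →
    IsFlow (augment φ es) (suc v)
  augmenting-path flow w unique = flow+1⇒flow (augment-along flow w unique)

  -- Residually closed sets

  complement-closed : ∀ {φ A} → ReverseReach.Closed φ A → ResidualReach.Closed φ (not ∘ A)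
  complement-closed {A = A} closed {x = x} {y} r ¬Ax with A y in Ay
  ... | false = refl
  ... | true = ⊥-elim (≡true⇒≢false ¬Ax (cong not (closed r Ay)))

  Saturates : (Fin m → Bool) → (Fin n → Bool) → Set
  Saturates φ C = (∀ e → outE C e ≡ true → φ e ≡ true) × (∀ e → inE C e ≡ true → φ e ≡ false)

  closed⇒saturates : ∀ {φ C} → ResidualReach.Closed φ C → Saturates φ C
  closed⇒saturates {φ} {C} closed = saturatedOut , emptyIn
    where
    saturatedOut : ∀ e → outE C e ≡ true → φ e ≡ true
    saturatedOut e out with ∧≡true out | φ e in φe
    ... | _ | true = refl
    ... | Csrc , ¬Ctgt | false = ⊥-elim (≡true⇒≢false (closed (forward φe) Csrc) (not≡true ¬Ctgt))
    emptyIn : ∀ e → inE C e ≡ true → φ e ≡ false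
    emptyIn e into with ∧≡true into | φ e in φe
    ... | _ | false = refl
    ... | ¬Csrc , Ctgt | true = ⊥-elim (≡true⇒≢false (closed (backward φe) Ctgt) (not≡true ¬Csrc))

  saturates⇒closed : ∀ {φ C} → Saturates φ C → ResidualReach.Closed φ C
  saturates⇒closed {C = C} (saturatedOut , _) {e} (forward φe) Csrc with C (tgt G e) in Ctgt
  ... | true = refl
  ... | false = ⊥-elim (≡true⇒≢false (saturatedOut e (cong₂ (λ a b → a ∧ not b) Csrc Ctgt)) φe)
  saturates⇒closed {C = C} (_ , emptyIn) {e} (backward φe) Ctgt with C (src G e) in Csrc
  ... | true = refl
  ... | false = ⊥-elim (≡true⇒≢false φe (emptyIn e (cong₂ (λ a b → not a ∧ b) Csrc Ctgt)))

  saturated-balance : ∀ {φ v C} → IsFlow φ v → Saturates φ C → count (outE C) + ⟦ C t ⟧ * v ≡ ⟦ C s ⟧ * v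
  saturated-balance {φ} {v} {C} flow (saturatedOut , emptyIn) = begin
    count (outE C) + ⟦ C t ⟧ * v  ≡˘⟨ cong (_+ ⟦ C t ⟧ * v) (count-cong full) ⟩
    fOut φ C + ⟦ C t ⟧ * v        ≡⟨ flow C ⟩
    fIn φ C + ⟦ C s ⟧ * v         ≡⟨ cong (_+ ⟦ C s ⟧ * v) (count-none _ empty) ⟩
    ⟦ C s ⟧ * v                   ∎
    where
    open ≡-Reasoning
    full : ∀ e → outE C e ∧ φ e ≡ outE C e
    full e with outE C e in out
    ... | true = saturatedOut e out
    ... | false = refl
    empty : ∀ e → inE C e ∧ φ e ≡ false
    empty e with inE C e in into
    ... | true = emptyIn e into
    ... | false = refl

  closed-cut-value : ∀ {φ v C} → IsFlow φ v → ResidualReach.Closed φ C → C s ≡ true → C t ≡ false →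
    count (outE C) ≡ v
  closed-cut-value {v = v} {C} flow closed Cs Ct =
    trans (sym (+-identityʳ _)) (trans balance (+-identityʳ v))
    where
    balance : count (outE C) + 0 ≡ v + 0
    balance = subst₂ (λ a b → count (outE C) + ⟦ a ⟧ * v ≡ ⟦ b ⟧ * v) Ct Cs
      (saturated-balance {C = C} flow (closed⇒saturates closed))

  -- The strip graph D_λ

  IsMinCut? : ∀ S → Dec (IsMinCut G s t S)
  IsMinCut? S = cut? S ×-dec allSubset? λ S′ → cut? S′ →-dec (cutSize G s t ∅ S ≤? cutSize G s t ∅ S′)
    where
    cut? : ∀ S → Dec (STCut G s t S)
    cut? S = (s ∈? S) ×-dec ¬? (t ∈? S)

  Equiv? : ∀ u v → Dec (Equiv G s t u v)
  Equiv? u v = allSubset? λ S → IsMinCut? S →-dec ((u ∈? S) ⇔? (v ∈? S))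

  Critical? : ∀ e → Dec (Critical G s t e)
  Critical? e = anySubset? λ S → IsMinCut? S ×-dec (src G e ∈? S) ×-dec ¬? (tgt G e ∈? S)

  equiv-refl : ∀ {x} → Equiv G s t x x
  equiv-refl S _ = ⇔.refl

  equiv-sym : ∀ {x y} → Equiv G s t x y → Equiv G s t y x
  equiv-sym x~y S mc = ⇔.sym (x~y S mc)

  equiv-trans : ∀ {x y z} → Equiv G s t x y → Equiv G s t y z → Equiv G s t x z
  equiv-trans x~y y~z S mc = ⇔.trans (x~y S mc) (y~z S mc)

  dpath-single : ∀ {e a b} → DArc G s t e a b → DPath G s t a b (e ∷ [])
  dpath-single arc = cons _ arc equiv-refl (nil equiv-refl)

  dpath-++ : ∀ {x y z ps qs} → DPath G s t x y ps → DPath G s t y z qs → DPath G s t x z (ps ++ qs)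
  dpath-++ (nil x~y) (nil y~z) = nil (equiv-trans x~y y~z)
  dpath-++ (nil x~y) (cons e arc y~a rest) = cons e arc (equiv-trans x~y y~a) rest
  dpath-++ (cons e arc x~a rest) q = cons e arc x~a (dpath-++ rest q)

  dpath-split : ∀ {x y e} ps qs → DPath G s t x y (ps ++ (e ∷ qs)) →
    ∃[ a ] ∃[ b ] DPath G s t x a ps × DArc G s t e a b × DPath G s t b y qs
  dpath-split [] qs (cons e arc x~a rest) = _ , _ , nil x~a , arc , rest
  dpath-split (p ∷ ps) qs (cons p arc x~a rest) with dpath-split ps qs rest
  ... | a , b , prefix , arc₁ , suffix = a , b , cons p arc x~a prefix , arc₁ , suffix

  critical⇒inter-cluster : ∀ {e} → Critical G s t e → InterCluster G s t e
  critical⇒inter-cluster (S , mc , src∈S , tgt∉S) src~tgt = tgt∉S (Equivalence.to (src~tgt S mc) src∈S)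

  critical-darc : ∀ {e} → Critical G s t e → DArc G s t e (src G e) (tgt G e)
  critical-darc crit = critical⇒inter-cluster crit , inj₁ (crit , refl , refl)

  critical-darc-ends : ∀ {e a b} → Critical G s t e → DArc G s t e a b → a ≡ src G e × b ≡ tgt G e
  critical-darc-ends _ (_ , inj₁ (_ , a≡src , b≡tgt)) = a≡src , b≡tgt
  critical-darc-ends crit (_ , inj₂ (noncrit , _ , _)) = contradiction crit noncrit

  -- Maximum flows and minimum cuts

  module MinCutValue (lam : ℕ) (hmin : IsMinCutSize G s t ∅ lam) where

    lam≤cut : ∀ C → C s ≡ true → C t ≡ false → lam ≤ count (outE C)
    lam≤cut C Cs Ct =
      subst (lam ≤_) (cutSize-∅ (tabulate C) (Vecₚ.lookup∘tabulate C)) (proj₂ hmin _ (tabulate-cut Cs Ct))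

    mincut-value : ∀ {S} → IsMinCut G s t S → count (outE (lookup S)) ≡ lam
    mincut-value {S} (cut , minimal) with proj₁ hmin
    ... | S₀ , cut₀ , S₀≡lam = trans (sym (cutSize-∅ S (λ _ → refl)))
      (≤-antisym (subst (cutSize G s t ∅ S ≤_) S₀≡lam (minimal S₀ cut₀)) (proj₂ hmin S cut))

    lam≢0 : ∀ {vs} → GWalk G s t s t vs → lam ≢ 0
    lam≢0 w lam≡0 with proj₁ hmin
    ... | S₀ , (s∈S₀ , t∉S₀) , S₀≡lam = t∉S₀ (lookup⇒∈ (walk-stays {lookup S₀} noExit w (∈⇒lookup s∈S₀)))
      where
      noExit : NoExit (lookup S₀)
      noExit = count-outE≡0⇒NoExit (lookup S₀) (trans (sym (cutSize-∅ S₀ (λ _ → refl))) (trans S₀≡lam lam≡0))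

    some-mincut : ∃[ S ] IsMinCut G s t S
    some-mincut with proj₁ hmin
    ... | S₀ , cut₀ , S₀≡lam = S₀ , cut₀ , λ S cut → subst (_≤ cutSize G s t ∅ S) (sym S₀≡lam) (proj₂ hmin S cut)

    deletion-bound : ∀ {E lam′} → IsMinCutSize G s t E lam′ → lam ≤ lam′ + ∣ E ∣
    deletion-bound {E} {lam′} ((S′ , cut′ , S′≡lam′) , _) = begin
      lam
        ≤⟨ proj₂ hmin S′ cut′ ⟩
      cutSize G s t ∅ S′
        ≡⟨ cutSize-split E S′ (λ _ → refl) ⟩
      count (λ e → lookup E e ∧ outE (lookup S′) e) + cutSize G s t E S′
        ≤⟨ +-mono-≤ (deleted-crossing≤ E {lookup S′}) (≤-reflexive S′≡lam′) ⟩
      ∣ E ∣ + lam′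
        ≡⟨ +-comm ∣ E ∣ lam′ ⟩
      lam′ + ∣ E ∣
        ∎
      where open ≤-Reasoning

    flow-from : ∀ d {φ v} → IsFlow φ v → v + d ≡ lam → ∃[ ψ ] IsFlow ψ lam
    flow-from zero {φ} flow v+0≡lam = φ , subst (IsFlow φ) (trans (sym (+-identityʳ _)) v+0≡lam) flow
    flow-from (suc d) {φ} {v} flow v+d+1≡lam = extend (ResidualReach.closure φ (singleton s))
      where
      extend : ResidualReach.Closure φ (singleton s) → ∃[ ψ ] IsFlow ψ lam
      extend record { C = C ; ⊇X = ⊇X ; closed = closed ; reachable = reachable } with C t in Ct
      ... | true with reachable t Ct
      ...   | x , x∈X , es , w , unique with witness (x Finₚ.≟ s) x∈X
      ...     | refl = flow-from d (augmenting-path flow w unique) (trans (sym (+-suc v d)) v+d+1≡lam)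
      extend record { C = C ; ⊇X = ⊇X ; closed = closed ; reachable = reachable } | false =
        contradiction (subst (lam ≤_) (closed-cut-value flow closed Cs Ct) (lam≤cut C Cs Ct))
          (<⇒≱ (subst (v <_) v+d+1≡lam (m<m+n v (s≤s z≤n))))
        where
        Cs : C s ≡ true
        Cs = ⊇X s (dec-true (s Finₚ.≟ s) refl)

    max-flow : ∃[ φ ] IsFlow φ lam
    max-flow = flow-from lam empty-flow refl

    module MaxFlow (φ : Fin m → Bool) (flow : IsFlow φ lam) where

      mincut⇒saturates : ∀ {S} → IsMinCut G s t S → Saturates φ (lookup S)
      mincut⇒saturates {S} mc@(cut , _) = count-∧⊆ (outE B) φ fullOutflow , emptyIn
        where
        B = lookup S
        balance : fOut φ B ≡ fIn φ B + lam
        balance = trans (sym (+-identityʳ _)) (trans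
          (subst₂ (λ a b → fOut φ B + ⟦ a ⟧ * lam ≡ fIn φ B + ⟦ b ⟧ * lam)
            (∉⇒lookup (proj₂ cut)) (∈⇒lookup (proj₁ cut)) (flow B))
          (cong (fIn φ B +_) (+-identityʳ lam)))
        noInflow : fIn φ B ≡ 0
        noInflow = n≤0⇒n≡0 (+-cancelʳ-≤ lam _ 0 (begin
          fIn φ B + lam   ≡˘⟨ balance ⟩
          fOut φ B        ≤⟨ count-mono {Q = outE B} (λ e → proj₁ ∘ ∧≡true) ⟩
          count (outE B)  ≡⟨ mincut-value mc ⟩
          lam             ∎))
          where open ≤-Reasoning
        fullOutflow : count (outE B) ≤ fOut φ B
        fullOutflow = ≤-reflexive (trans (mincut-value mc) (sym (trans balance (cong (_+ lam) noInflow))))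
        emptyIn : ∀ e → inE B e ≡ true → φ e ≡ false
        emptyIn e into = subst (λ b → b ∧ φ e ≡ false) into (count≡0 _ noInflow e)

      mincut-closed : ∀ {S} → IsMinCut G s t S → ResidualReach.Closed φ (lookup S)
      mincut-closed = saturates⇒closed ∘ mincut⇒saturates

      mincut-reach : ∀ {S x y es} → IsMinCut G s t S → ResidualReach.Walk φ x y es → x ∈ S → y ∈ S
      mincut-reach mc w x∈S = lookup⇒∈ (ResidualReach.walk-closed φ (mincut-closed mc) w (∈⇒lookup x∈S))

      critical⇒saturated : ∀ {e} → Critical G s t e → φ e ≡ true
      critical⇒saturated {e} (S , mc , src∈S , tgt∉S) =
        proj₁ (mincut⇒saturates mc) e (cong₂ (λ a b → a ∧ not b) (∈⇒lookup src∈S) (∉⇒lookup tgt∉S))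

      saturated-noncritical⇒equiv : ∀ {e} → ¬ Critical G s t e → φ e ≡ true → Equiv G s t (src G e) (tgt G e)
      saturated-noncritical⇒equiv {e} noncrit φe S mc = mk⇔ to from
        where
        to : src G e ∈ S → tgt G e ∈ S
        to src∈S with tgt G e ∈? S
        ... | yes tgt∈S = tgt∈S
        ... | no tgt∉S = contradiction (S , mc , src∈S , tgt∉S) noncrit
        from : tgt G e ∈ S → src G e ∈ S
        from tgt∈S = lookup⇒∈ (mincut-closed mc (backward φe) (∈⇒lookup tgt∈S))

      residual⇒dpath : ∀ {e y z} → Residual φ e y z → ∃[ ds ] DPath G s t z y ds
      residual⇒dpath {e} r with Equiv? (src G e) (tgt G e) | Critical? e | r
      ... | yes src~tgt | _ | forward _ = [] , nil (equiv-sym src~tgt)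
      ... | yes src~tgt | _ | backward _ = [] , nil src~tgt
      ... | no inter | yes crit | forward φe = ⊥-elim (≡true⇒≢false (critical⇒saturated crit) φe)
      ... | no inter | no noncrit | forward _ = e ∷ [] , dpath-single (inter , inj₂ (noncrit , refl , refl))
      ... | no inter | yes crit | backward _ = e ∷ [] , dpath-single (critical-darc crit)
      ... | no inter | no noncrit | backward φe = contradiction (saturated-noncritical⇒equiv noncrit φe) inter

      darc-closed : ∀ {e a b S} → DArc G s t e a b → IsMinCut G s t S → b ∈ S → a ∈ S
      darc-closed (_ , inj₁ (crit , refl , refl)) mc tgt∈S =
        lookup⇒∈ (mincut-closed mc (backward (critical⇒saturated crit)) (∈⇒lookup tgt∈S))
      darc-closed {e} {S = S} (_ , inj₂ (noncrit , refl , refl)) mc src∈S with tgt G e ∈? S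
      ... | yes tgt∈S = tgt∈S
      ... | no tgt∉S = contradiction (S , mc , src∈S , tgt∉S) noncrit

      dpath-closed : ∀ {x y ds S} → IsMinCut G s t S → DPath G s t x y ds → y ∈ S → x ∈ S
      dpath-closed mc (nil x~y) y∈S = Equivalence.from (x~y _ mc) y∈S
      dpath-closed mc (cons e arc x~a rest) y∈S = Equivalence.from (x~a _ mc) (darc-closed arc mc (dpath-closed mc rest y∈S))

      closed-balance : ∀ {B} → ResidualReach.Closed φ B → count (outE B) + ⟦ B t ⟧ * lam ≡ ⟦ B s ⟧ * lam
      closed-balance {B} closed = saturated-balance {C = B} flow (closed⇒saturates closed)

      closed-without-s : ∀ {B vs v} → ResidualReach.Closed φ B → B s ≡ false →
        GWalk G s t s t vs → v List.∈ vs → B v ≡ false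
      closed-without-s {B} {v = v} closed Bs w v∈vs with B v in Bv
      ... | false = refl
      ... | true = contradiction (m+n≡0⇒m≡0 lam (subst (λ b → ⟦ b ⟧ * lam ≡ 0) Bt (m+n≡0⇒n≡0 _ balance))) (lam≢0 w)
        where
        balance : count (outE B) + ⟦ B t ⟧ * lam ≡ 0
        balance = trans (closed-balance closed) (cong (λ b → ⟦ b ⟧ * lam) Bs)
        Bt : B t ≡ true
        Bt = walk-stays-after (count-outE≡0⇒NoExit B (m+n≡0⇒m≡0 _ balance)) w v∈vs Bv

      closed-with-t : ∀ {B vs v} → ResidualReach.Closed φ B → B t ≡ true →
        GWalk G s t s t vs → v List.∈ vs → B v ≡ true
      closed-with-t {B} closed Bt w v∈vs with B s in Bs
      ... | true = walk-stays-within (count-outE≡0⇒NoExit B (+-cancelʳ-≡ (lam + 0) _ 0 balance)) w Bs v∈vs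
        where
        balance : count (outE B) + (lam + 0) ≡ lam + 0
        balance = subst₂ (λ a b → count (outE B) + ⟦ a ⟧ * lam ≡ ⟦ b ⟧ * lam) Bt Bs (closed-balance closed)
      ... | false = contradiction (m+n≡0⇒m≡0 lam (m+n≡0⇒n≡0 (count (outE B)) balance)) (lam≢0 w)
        where
        balance : count (outE B) + (lam + 0) ≡ 0
        balance = subst₂ (λ a b → count (outE B) + ⟦ a ⟧ * lam ≡ ⟦ b ⟧ * lam) Bt Bs (closed-balance closed)

      residual-walk⇒dpath : ∀ {x y es} → ResidualReach.Walk φ x y es → ∃[ ds ] DPath G s t y x ds
      residual-walk⇒dpath nil = [] , nil equiv-refl
      residual-walk⇒dpath (snoc w e r) with residual-walk⇒dpath w | residual⇒dpath r
      ... | _ , back | _ , arc = _ , dpath-++ arc back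

      reverse-walk⇒dpath : ∀ {x y es} → ReverseReach.Walk φ x y es → ∃[ ds ] DPath G s t x y ds
      reverse-walk⇒dpath ReverseReach.nil = [] , nil equiv-refl
      reverse-walk⇒dpath (ReverseReach.snoc w e r) with reverse-walk⇒dpath w | residual⇒dpath r
      ... | _ , forth | _ , arc = _ , dpath-++ forth arc

      dpath-from-s : (∀ v → OnSimpleSTPath G s t v) → ∀ v → ∃[ ds ] DPath G s t s v ds
      dpath-from-s onPath v = from (ReverseReach.closure φ (singleton s))
        where
        from : ReverseReach.Closure φ (singleton s) → ∃[ ds ] DPath G s t s v ds
        from record { C = A ; ⊇X = ⊇X ; closed = closed ; reachable = reachable } with A v in Av
        ... | true with reachable v Av
        ...   | x , x∈X , _ , w , _ with witness (x Finₚ.≟ s) x∈X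
        ...     | refl = reverse-walk⇒dpath w
        from record { C = A ; ⊇X = ⊇X ; closed = closed ; reachable = reachable } | false with onPath v
        ... | _ , w , _ , v∈vs =
          ⊥-elim (≡true⇒≢false (cong not Av) (closed-without-s (complement-closed closed) As w v∈vs))
          where
          As : not (A s) ≡ false
          As = cong not (⊇X s (dec-true (s Finₚ.≟ s) refl))

      dpath-to-t : (∀ v → OnSimpleSTPath G s t v) → ∀ v → ∃[ ds ] DPath G s t v t ds
      dpath-to-t onPath v = to (ResidualReach.closure φ (singleton t))
        where
        to : ResidualReach.Closure φ (singleton t) → ∃[ ds ] DPath G s t v t ds
        to record { C = C ; ⊇X = ⊇X ; closed = closed ; reachable = reachable } with C v in Cv
        ... | true with reachable v Cv
        ...   | x , x∈X , _ , w , _ with witness (x Finₚ.≟ t) x∈X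
        ...     | refl = residual-walk⇒dpath w
        to record { C = C ; ⊇X = ⊇X ; closed = closed ; reachable = reachable } | false with onPath v
        ... | _ , w , _ , v∈vs =
          ⊥-elim (≡true⇒≢false (closed-with-t closed (⊇X t (dec-true (t Finₚ.≟ t) refl)) w v∈vs) Cv)

      tight⇒critical-antichain : ∀ {E lam′} → IsMinCutSize G s t E lam′ → lam ≡ lam′ + ∣ E ∣ →
        AllCritical G s t E × AntiChain G s t E
      tight⇒critical-antichain {E} {lam′} ((S′ , cut′ , S′≡lam′) , _) tight = critical , antichain
        where
        k = count (λ e → lookup E e ∧ outE (lookup S′) e)
        split : cutSize G s t ∅ S′ ≡ k + lam′
        split = trans (cutSize-split E S′ (λ _ → refl)) (cong (k +_) S′≡lam′)
        E≤k : ∣ E ∣ ≤ k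
        E≤k = +-cancelʳ-≤ lam′ _ _ (begin
          ∣ E ∣ + lam′        ≡⟨ +-comm ∣ E ∣ lam′ ⟩
          lam′ + ∣ E ∣        ≡˘⟨ tight ⟩
          lam                 ≤⟨ proj₂ hmin S′ cut′ ⟩
          cutSize G s t ∅ S′  ≡⟨ split ⟩
          k + lam′            ∎)
          where open ≤-Reasoning
        mincut : IsMinCut G s t S′
        mincut = cut′ , λ S″ cut″ → ≤-trans (begin
          cutSize G s t ∅ S′  ≡⟨ split ⟩
          k + lam′            ≤⟨ +-monoˡ-≤ lam′ (deleted-crossing≤ E {lookup S′}) ⟩
          ∣ E ∣ + lam′        ≡⟨ +-comm ∣ E ∣ lam′ ⟩
          lam′ + ∣ E ∣        ≡˘⟨ tight ⟩
          lam                 ∎) (proj₂ hmin S″ cut″)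
          where open ≤-Reasoning
        crosses : ∀ e → e ∈ E → src G e ∈ S′ × tgt G e ∉ S′
        crosses e e∈E = outE⇒crossing (count-∧⊆ (lookup E) (outE (lookup S′))
          (subst (_≤ k) (card≡count E) E≤k) e (∈⇒lookup e∈E))
        critical : AllCritical G s t E
        critical e e∈E = S′ , mincut , crosses e e∈E
        antichain : AntiChain G s t E
        antichain e f e∈E f∈E e≢f (inj₁ e≡f) = e≢f e≡f
        antichain e f e∈E f∈E e≢f (inj₂ (p , q , r , path)) with dpath-split p (q ++ (f ∷ r)) path
        ... | _ , _ , _ , arc₁ , rest with dpath-split q r rest | critical-darc-ends (critical e e∈E) arc₁
        ...   | _ , _ , between , arc₂ , _ | refl , refl with critical-darc-ends (critical f f∈E) arc₂
        ...     | refl , refl = proj₂ (crosses e e∈E) (dpath-closed mincut between (proj₁ (crosses f f∈E)))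

      critical-antichain⇒tight : (∀ v → OnSimpleSTPath G s t v) → ∀ {E lam′} → IsMinCutSize G s t E lam′ →
        AllCritical G s t E × AntiChain G s t E → lam ≡ lam′ + ∣ E ∣
      critical-antichain⇒tight onPath {E} {lam′} hE (critical , antichain) =
        ≤-antisym (deletion-bound {E} hE) (deletion-cut (ResidualReach.closure φ seed))
        where
        Seed : Fin n → Set
        Seed v = v ≡ s ⊎ ∃[ e ] e ∈ E × src G e ≡ v
        seed? : ∀ v → Dec (Seed v)
        seed? v = (v Finₚ.≟ s) ⊎-dec Finₚ.any? λ e → (e ∈? E) ×-dec (src G e Finₚ.≟ v)
        seed : Fin n → Bool
        seed v = does (seed? v)

        seed-in-mincut : ∀ {x} → Seed x → ∃[ S ] IsMinCut G s t S × x ∈ S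
        seed-in-mincut (inj₁ refl) with some-mincut
        ... | S₀ , mc₀ = S₀ , mc₀ , proj₁ (proj₁ mc₀)
        seed-in-mincut (inj₂ (e , e∈E , refl)) with critical e e∈E
        ... | S , mc , src∈S , _ = S , mc , src∈S

        module _ (closure : ResidualReach.Closure φ seed) where
          open ResidualReach.Closure φ closure

          misses-t : C t ≡ false
          misses-t with C t in Ct
          ... | false = refl
          ... | true with reachable t Ct
          ...   | x , x∈seed , _ , w , _ with seed-in-mincut (witness (seed? x) x∈seed)
          ...     | S , mc , x∈S = ⊥-elim (proj₂ (proj₁ mc) (mincut-reach mc w x∈S))

          -- A residual walk from the tail of e ∈ E to the head of f ∈ E, f ≠ e, reverses into a
          -- D_λ-path from the head of f to the tail of e, which would put f before e.
          misses-heads : ∀ f → f ∈ E → C (tgt G f) ≡ false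
          misses-heads f f∈E with C (tgt G f) in Cf
          ... | false = refl
          ... | true with reachable (tgt G f) Cf | critical f f∈E
          ...   | x , x∈seed , _ , w , _ | S , mc , src∈S , tgt∉S with witness (seed? x) x∈seed
          ...     | inj₁ refl = ⊥-elim (tgt∉S (mincut-reach mc w (proj₁ (proj₁ mc))))
          ...     | inj₂ (e , e∈E , refl) with e Finₚ.≟ f
          ...       | yes refl = ⊥-elim (tgt∉S (mincut-reach mc w src∈S))
          ...       | no e≢f with dpath-from-s onPath (src G f) | residual-walk⇒dpath w | dpath-to-t onPath (tgt G e)
          ...         | p , s⇝f | q , f⇝e | r , e⇝t = ⊥-elim (antichain f e f∈E e∈E (e≢f ∘ sym) (inj₂ (p , q , r ,
            dpath-++ s⇝f (cons f (critical-darc (critical f f∈E)) equiv-refl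
              (dpath-++ f⇝e (cons e (critical-darc (critical e e∈E)) equiv-refl e⇝t))))))

          deletion-cut : lam′ + ∣ E ∣ ≤ lam
          deletion-cut = begin
            lam′ + ∣ E ∣
              ≤⟨ +-monoˡ-≤ ∣ E ∣ (proj₂ hE (tabulate C) (tabulate-cut Cs misses-t)) ⟩
            cutSize G s t E (tabulate C) + ∣ E ∣
              ≡⟨ +-comm _ ∣ E ∣ ⟩
            ∣ E ∣ + cutSize G s t E (tabulate C)
              ≡⟨ cong (_+ cutSize G s t E (tabulate C)) all-cross ⟩
            count (λ e → lookup E e ∧ outE C e) + cutSize G s t E (tabulate C)
              ≡˘⟨ cutSize-split E (tabulate C) (Vecₚ.lookup∘tabulate C) ⟩
            cutSize G s t ∅ (tabulate C)
              ≡⟨ cutSize-∅ (tabulate C) (Vecₚ.lookup∘tabulate C) ⟩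
            count (outE C)
              ≡⟨ closed-cut-value flow closed Cs misses-t ⟩
            lam
              ∎
            where
            open ≤-Reasoning
            Cs : C s ≡ true
            Cs = ⊇X s (dec-true (seed? s) (inj₁ refl))
            all-cross : ∣ E ∣ ≡ count (λ e → lookup E e ∧ outE C e)
            all-cross = trans (card≡count E) (count-cong crosses)
              where
              crosses : ∀ e → lookup E e ≡ lookup E e ∧ outE C e
              crosses e with lookup E e in e∈E
              ... | false = refl
              ... | true rewrite ⊇X (src G e) (dec-true (seed? (src G e)) (inj₂ (e , lookup⇒∈ e∈E , refl)))
                               | misses-heads e (lookup⇒∈ e∈E) = refl

lemma11 : ∀ {n m} (G : Graph n m) → Simple G → (s t : Fin n) → s ≢ t
    → (∀ v → OnSimpleSTPath G s t v)
    → (lam : ℕ) → IsMinCutSize G s t ∅ lam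
    → (E : Subset m) (lam' : ℕ) → IsMinCutSize G s t E lam'
    → (lam ≡ lam' + ∣ E ∣ ⇔ (AllCritical G s t E × AntiChain G s t E))
lemma11 G _ s t _ onPath lam hmin E lam' hE =
  mk⇔ (tight⇒critical-antichain hE) (critical-antichain⇒tight onPath hE)
  where
  open Network G s t
  open MinCutValue lam hmin
  open MaxFlow (proj₁ max-flow) (proj₂ max-flow)
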